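{- Let $n,k,\ell\geq1$ and $m\geq0$, and let $X\subseteq\mathbb{N}$ be a finite $\omega^{n+m}\cdot(k\ell+1)$-large set with $k(\ell+1)\leq\min X$. Then there exist $d\in\mathbb{N}$ and $\omega^n\cdot k$-large subsets $X_0<\dots<X_{d-1}$ of $X$ such that $\{\max X_i:i<d\}$ is $\omega^m\cdot\ell$-large.
   Context: $X<Y$ means every element of $X$ is below every element of $Y$. Fundamental sequences: $\{0\}(x)=0$; for $\alpha\neq0$ write $\alpha=\delta+\omega^\gamma$ in Cantor normal form with $\omega^\gamma$ the last term; $\{\alpha\}(x)=\delta$ if $\gamma=0$, $\delta+\omega^{\gamma'}\cdot x$ if $\gamma=\gamma'+1$, $\delta+\omega^{\{\gamma\}(x)}$ if $\gamma$ is a limit. For finite $X=\{x_0<\dots<x_s\}$, $\{\alpha\}(X)=\{\cdots\{\{\alpha\}(x_0)\}(x_1)\cdots\}(x_s)$ and $X$ is $\alpha$-large iff $\{\alpha\}(X)=0$. -}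

module Defs where

open import Data.Nat using (ℕ; zero; suc; _+_; _*_; _<_; _⊔_)
open import Data.List using (List; []; _∷_; foldr)
open import Data.List.Relation.Unary.All using (All)
open import Data.List.Relation.Unary.Linked using (Linked)
open import Data.List.Membership.Propositional using (_∈_)
open import Relation.Binary.PropositionalEquality using (_≡_)

-- Ordinal notations in Cantor normal form, written from the LAST term:
-- δ ⊕ω^ γ  denotes  δ + ω^γ  (ω^γ the last CNF term).
data Ord : Set where
  𝟎     : Ord
  _⊕ω^_ : Ord → Ord → Ord

infixl 6 _⊕ω^_

addPowMul : Ord → Ord → ℕ → Ord
addPowMul δ γ zero    = δ
addPowMul δ γ (suc x) = addPowMul δ γ x ⊕ω^ γ

fin : ℕ → Ord
fin n = addPowMul 𝟎 𝟎 n

ωpowMul : Ord → ℕ → Ord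
ωpowMul γ = addPowMul 𝟎 γ

fs : Ord → ℕ → Ord
fs 𝟎 x = 𝟎
fs (δ ⊕ω^ 𝟎) x = δ
fs (δ ⊕ω^ (γ' ⊕ω^ 𝟎)) x = addPowMul δ γ' x
fs (δ ⊕ω^ (γ@(_ ⊕ω^ (_ ⊕ω^ _)))) x = δ ⊕ω^ fs γ x

-- Finite sets of naturals are strictly increasing lists x₀ < … < xₛ.
IsSet : List ℕ → Set
IsSet = Linked _<_

fsSet : Ord → List ℕ → Ord
fsSet α []       = α
fsSet α (x ∷ xs) = fsSet (fs α x) xs

Large : Ord → List ℕ → Set
Large α X = fsSet α X ≡ 𝟎

_≺_ : List ℕ → List ℕ → Set
X ≺ Y = All (λ x → All (x <_) Y) X

_⊆_ : List ℕ → List ℕ → Set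
Y ⊆ X = All (_∈ X) Y

maxL : List ℕ → ℕ
maxL = foldr _⊔_ 0

{-# OPTIONS --safe #-}
module Submission where

-- Exactly large sets (reaching 0 exactly at their last element) split along sums of ordinals,
-- which makes a block-by-block construction possible. For m = 0, cut off ℓ consecutive exactly
-- ω^n·k-large groups. For m + 1, the set starts with some z ≥ k, so its first part is exactly
-- ω^(m+n)·z-large and contains a first group; let y be its maximum. Every target term ω^(m+1) is
-- then paid for by k blocks ω^(m+1+n) above y: each contains an ω^(m+n)·(y+1)-large part, together
-- an ω^(m+n)·k(y+1)-large set, which by induction yields groups whose maxima are ω^m·y-large (the
-- fundamental sequence of ω^(m+1) at y) and one spare group. The maximum of the spare group is the
-- y of the next term.

open import Defs
open import Data.Nat using (ℕ; zero; suc; _+_; _*_; _≤_; _<_; z≤n; s≤s; NonZero; >-nonZero; >-nonZero⁻¹)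
open import Data.Nat.Properties
  using (+-comm; *-comm; ≤-trans; <-trans; +-monoˡ-≤; ⊔-pres-<m; ≤-<-trans; n≤1+n; m≤m*n; m≤n⇒∃[o]m+o≡n)
open import Data.Fin using (Fin) renaming (_<_ to _<ᶠ_)
import Data.Fin as Fin
open import Data.Vec using (Vec; lookup; toList; fromList)
open import Data.Vec.Properties using (toList∘fromList)
import Data.Vec.Relation.Unary.All.Properties as VecAllₚ
open import Data.List using (List; []; _∷_; _++_; map; concat; replicate; length)
open import Data.List.Properties using (++-assoc; ++-identityʳ; map-++; concat-++; foldr-preservesᵇ)
open import Data.List.Relation.Unary.All using (All; []; _∷_)
import Data.List.Relation.Unary.All as All
import Data.List.Relation.Unary.All.Properties as Allₚ
open import Data.List.Relation.Unary.AllPairs using (AllPairs; []; _∷_)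
open import Data.List.Relation.Unary.Linked.Properties using (AllPairs⇒Linked; Linked⇒AllPairs)
open import Data.List.Relation.Binary.Sublist.Propositional
  using ([]; _∷_; _∷ʳ_; ⊆-refl; ⊆-trans) renaming (_⊆_ to _⊑_)
import Data.List.Relation.Binary.Sublist.Propositional.Properties as Subₚ
open import Data.List.Relation.Binary.Sublist.Heterogeneous using (minimum)
open import Data.Product using (Σ; _×_; _,_; ∃-syntax)
open import Relation.Binary.PropositionalEquality
  using (_≡_; refl; sym; trans; cong; subst; subst₂; module ≡-Reasoning)

-- Ordinals below ω^ω as stacks of exponents, the exponent of the last CNF term first.
Stack : Set
Stack = List ℕ

private
  variable
    A : Set
    e a b c x y : ℕ
    s t : Stack
    G X Y Z : List ℕ

⟦_⟧ : Stack → Ord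
⟦ [] ⟧    = 𝟎
⟦ e ∷ s ⟧ = ⟦ s ⟧ ⊕ω^ fin e

infix 8 ω^_·_
ω^_·_ : ℕ → ℕ → Stack
ω^ e · c = replicate c e

step : Stack → ℕ → Stack
step []          x = []
step (zero ∷ s)  x = s
step (suc e ∷ s) x = ω^ e · x ++ s

run : Stack → List ℕ → Stack
run s []      = s
run s (x ∷ X) = run (step s x) X

addPowMul-⟦⟧ : ∀ s e c → addPowMul ⟦ s ⟧ (fin e) c ≡ ⟦ ω^ e · c ++ s ⟧
addPowMul-⟦⟧ s e zero    = refl
addPowMul-⟦⟧ s e (suc c) = cong (_⊕ω^ fin e) (addPowMul-⟦⟧ s e c)

fs-⟦⟧ : ∀ s x → fs ⟦ s ⟧ x ≡ ⟦ step s x ⟧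
fs-⟦⟧ []          x = refl
fs-⟦⟧ (zero ∷ s)  x = refl
fs-⟦⟧ (suc e ∷ s) x = addPowMul-⟦⟧ s e x

fsSet-⟦⟧ : ∀ s X → fsSet ⟦ s ⟧ X ≡ ⟦ run s X ⟧
fsSet-⟦⟧ s []      = refl
fsSet-⟦⟧ s (x ∷ X) = trans (cong (λ α → fsSet α X) (fs-⟦⟧ s x)) (fsSet-⟦⟧ (step s x) X)

ωpowMul-⟦⟧ : ∀ e c → ωpowMul (fin e) c ≡ ⟦ ω^ e · c ⟧
ωpowMul-⟦⟧ e c = trans (addPowMul-⟦⟧ [] e c) (cong ⟦_⟧ (++-identityʳ (ω^ e · c)))

⟦⟧≡𝟎⇒≡[] : ∀ s → ⟦ s ⟧ ≡ 𝟎 → s ≡ []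
⟦⟧≡𝟎⇒≡[] [] _ = refl

Large⇒run≡[] : ∀ e c X → Large (ωpowMul (fin e) c) X → run (ω^ e · c) X ≡ []
Large⇒run≡[] e c X large = ⟦⟧≡𝟎⇒≡[] _ (begin
  ⟦ run (ω^ e · c) X ⟧        ≡⟨ sym (fsSet-⟦⟧ (ω^ e · c) X) ⟩
  fsSet ⟦ ω^ e · c ⟧ X        ≡⟨ cong (λ α → fsSet α X) (sym (ωpowMul-⟦⟧ e c)) ⟩
  fsSet (ωpowMul (fin e) c) X ≡⟨ large ⟩
  𝟎                           ∎)
  where open ≡-Reasoning

data ExactlyLarge : Stack → List ℕ → Set where
  done : ExactlyLarge [] []
  next : ExactlyLarge (step (e ∷ s) x) X → ExactlyLarge (e ∷ s) (x ∷ X)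

infixr 5 _⁀_
data _⁀_ (P Q : List ℕ → Set) : List ℕ → Set where
  split : P Y → Q Z → (P ⁀ Q) (Y ++ Z)

exactlyLarge⇒run≡[] : ExactlyLarge s X → run s X ≡ []
exactlyLarge⇒run≡[] done     = refl
exactlyLarge⇒run≡[] (next p) = exactlyLarge⇒run≡[] p

run≡[]⇒sub-exactlyLarge : ∀ s X → run s X ≡ [] → ∃[ Y ] Y ⊑ X × ExactlyLarge s Y
run≡[]⇒sub-exactlyLarge []      X       _ = [] , minimum X , done
run≡[]⇒sub-exactlyLarge (e ∷ s) (x ∷ X) r with run≡[]⇒sub-exactlyLarge (step (e ∷ s) x) X r
... | Y , Y⊑X , p = x ∷ Y , refl ∷ Y⊑X , next p

Large⇒sub-exactlyLarge : ∀ e c X → Large (ωpowMul (fin e) c) X →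
                         ∃[ Y ] Y ⊑ X × ExactlyLarge (ω^ e · c) Y
Large⇒sub-exactlyLarge e c X large = run≡[]⇒sub-exactlyLarge (ω^ e · c) X (Large⇒run≡[] e c X large)

exactlyLarge⇒Large : ExactlyLarge (ω^ e · c) X → Large (ωpowMul (fin e) c) X
exactlyLarge⇒Large {e} {c} {X} p = begin
  fsSet (ωpowMul (fin e) c) X ≡⟨ cong (λ α → fsSet α X) (ωpowMul-⟦⟧ e c) ⟩
  fsSet ⟦ ω^ e · c ⟧ X        ≡⟨ fsSet-⟦⟧ (ω^ e · c) X ⟩
  ⟦ run (ω^ e · c) X ⟧        ≡⟨ cong ⟦_⟧ (exactlyLarge⇒run≡[] p) ⟩
  𝟎                           ∎
  where open ≡-Reasoning

step-++ : ∀ e s t x → step (e ∷ s) x ++ t ≡ step (e ∷ s ++ t) x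
step-++ zero    s t x = refl
step-++ (suc e) s t x = ++-assoc (ω^ e · x) s t

-- The stack s ++ t denotes ⟦ t ⟧ + ⟦ s ⟧, whose fundamental sequences use up ⟦ s ⟧ first.
exactlyLarge-++⁺ : ExactlyLarge s Y → ExactlyLarge t Z → ExactlyLarge (s ++ t) (Y ++ Z)
exactlyLarge-++⁺ done q = q
exactlyLarge-++⁺ {e ∷ s} {x ∷ Y} {t} (next p) q =
  next (subst (λ u → ExactlyLarge u _) (step-++ e s t x) (exactlyLarge-++⁺ p q))

exactlyLarge-++⁻ : ∀ s → ExactlyLarge (s ++ t) X → (ExactlyLarge s ⁀ ExactlyLarge t) X
exactlyLarge-++⁻ []      p = split done p
exactlyLarge-++⁻ {t = t} {X = x ∷ X} (e ∷ s) (next p)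
  with exactlyLarge-++⁻ (step (e ∷ s) x) (subst (λ u → ExactlyLarge u X) (sym (step-++ e s t x)) p)
... | split p₁ p₂ = split (next p₁) p₂

ω^·-+ : ∀ e a b → ω^ e · (a + b) ≡ ω^ e · a ++ ω^ e · b
ω^·-+ e zero    b = refl
ω^·-+ e (suc a) b = cong (e ∷_) (ω^·-+ e a b)

exactlyLarge-ω^·-+⁺ : ExactlyLarge (ω^ e · a) Y → ExactlyLarge (ω^ e · b) Z →
                      ExactlyLarge (ω^ e · (a + b)) (Y ++ Z)
exactlyLarge-ω^·-+⁺ {e} {a} {b = b} p q =
  subst (λ u → ExactlyLarge u _) (sym (ω^·-+ e a b)) (exactlyLarge-++⁺ p q)

exactlyLarge-ω^·-+⁻ : ∀ a → ExactlyLarge (ω^ e · (a + b)) X →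
                      (ExactlyLarge (ω^ e · a) ⁀ ExactlyLarge (ω^ e · b)) X
exactlyLarge-ω^·-+⁻ {e} {b} a p =
  exactlyLarge-++⁻ (ω^ e · a) (subst (λ u → ExactlyLarge u _) (ω^·-+ e a b) p)

sub-fewerTerms : a ≤ c → ExactlyLarge (ω^ e · c) Y → ∃[ Y′ ] Y′ ⊑ Y × ExactlyLarge (ω^ e · a) Y′
sub-fewerTerms {a} a≤c p with m≤n⇒∃[o]m+o≡n a≤c
... | _ , refl with exactlyLarge-ω^·-+⁻ a p
... | split {Y₁} {Y₂} p₁ _ = Y₁ , Subₚ.++⁺ʳ Y₂ ⊆-refl , p₁

sub-lowerExponent : ∀ m → a ≤ c → ExactlyLarge (ω^ (m + e) · c) Y → All (a ≤_) Y →
                    ∃[ G ] G ⊑ Y × ExactlyLarge (ω^ e · a) G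
sub-lowerExponent zero a≤c p _ = sub-fewerTerms a≤c p
sub-lowerExponent {c = zero} (suc m) z≤n done [] = [] , [] , done
sub-lowerExponent {c = suc c} {e = e} (suc m) _ (next {x = z} p) (a≤z ∷ Y≥a)
  with exactlyLarge-++⁻ (ω^ (m + e) · z) p
... | split {Y₁} {Y₂} p₁ _ with sub-lowerExponent m a≤z p₁ (Allₚ.++⁻ˡ Y₁ Y≥a)
... | G , G⊑Y₁ , q = G , z ∷ʳ Subₚ.++⁺ʳ Y₂ G⊑Y₁ , q

sub-expand : ∀ i → ExactlyLarge (ω^ suc e · i) Y → All (y <_) Y →
             ∃[ Y′ ] Y′ ⊑ Y × ExactlyLarge (ω^ e · (i * suc y)) Y′
sub-expand zero    done     []          = [] , [] , done
sub-expand {e} (suc i) (next {x = z} p) (y<z ∷ Y>y) with exactlyLarge-++⁻ (ω^ e · z) p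
... | split {Y₁} p₁ p₂ with sub-fewerTerms y<z p₁ | sub-expand i p₂ (Allₚ.++⁻ʳ Y₁ Y>y)
... | Y₁′ , Y₁′⊑Y₁ , q₁ | Y₂′ , Y₂′⊑Y₂ , q₂ =
  Y₁′ ++ Y₂′ , z ∷ʳ Subₚ.++⁺ Y₁′⊑Y₁ Y₂′⊑Y₂ , exactlyLarge-ω^·-+⁺ q₁ q₂

blocks : ∀ k c → ExactlyLarge (ω^ e · (c * k)) Y →
         ∃[ Gs ] All (ExactlyLarge (ω^ e · k)) Gs × concat Gs ≡ Y ×
                 ExactlyLarge (ω^ 0 · c) (map maxL Gs)
blocks k zero    done = [] , [] , refl , done
blocks k (suc c) p with exactlyLarge-ω^·-+⁻ k p
... | split p₁ p₂ with blocks k c p₂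
... | Gs , Gs-exact , refl , maxima = _ ∷ Gs , p₁ ∷ Gs-exact , refl , next maxima

Sorted : List ℕ → Set
Sorted = AllPairs _<_

AllPairs-resp-⊑ : {R : A → A → Set} {xs ys : List A} → xs ⊑ ys → AllPairs R ys → AllPairs R xs
AllPairs-resp-⊑ []           []         = []
AllPairs-resp-⊑ (_ ∷ʳ xs⊑ys) (_ ∷ p)    = AllPairs-resp-⊑ xs⊑ys p
AllPairs-resp-⊑ (refl ∷ xs⊑ys) (r ∷ p)  = Subₚ.All-resp-⊆ xs⊑ys r ∷ AllPairs-resp-⊑ xs⊑ys p

AllPairs-++⁻ʳ : {R : A → A → Set} (xs : List A) {ys : List A} → AllPairs R (xs ++ ys) → AllPairs R ys
AllPairs-++⁻ʳ []       p       = p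
AllPairs-++⁻ʳ (x ∷ xs) (_ ∷ p) = AllPairs-++⁻ʳ xs p

AllPairs-++⁻-between : {R : A → A → Set} (xs : List A) {ys : List A} →
                       AllPairs R (xs ++ ys) → All (λ x → All (R x) ys) xs
AllPairs-++⁻-between []       p       = []
AllPairs-++⁻-between (x ∷ xs) (r ∷ p) = Allₚ.++⁻ʳ xs r ∷ AllPairs-++⁻-between xs p

AllPairs-concat⁻ : {R : A → A → Set} (xss : List (List A)) →
                   AllPairs R (concat xss) → AllPairs (λ xs ys → All (λ x → All (R x) ys) xs) xss
AllPairs-concat⁻ []         _ = []
AllPairs-concat⁻ (xs ∷ xss) p =
  Allₚ.All-swap (All.map Allₚ.concat⁻ (AllPairs-++⁻-between xs p)) ∷
  AllPairs-concat⁻ xss (AllPairs-++⁻ʳ xs p)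

concat-++-∷ : ∀ (Gs₁ : List (List A)) T₁ Gs₂ T₂ →
              concat (Gs₁ ++ T₁ ∷ Gs₂) ++ T₂ ≡ (concat Gs₁ ++ T₁) ++ (concat Gs₂ ++ T₂)
concat-++-∷ Gs₁ T₁ Gs₂ T₂ = begin
  concat (Gs₁ ++ T₁ ∷ Gs₂) ++ T₂              ≡⟨ cong (_++ T₂) (sym (concat-++ Gs₁ (T₁ ∷ Gs₂))) ⟩
  (concat Gs₁ ++ T₁ ++ concat Gs₂) ++ T₂      ≡⟨ ++-assoc (concat Gs₁) (T₁ ++ concat Gs₂) T₂ ⟩
  concat Gs₁ ++ (T₁ ++ concat Gs₂) ++ T₂      ≡⟨ cong (concat Gs₁ ++_) (++-assoc T₁ (concat Gs₂) T₂) ⟩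
  concat Gs₁ ++ T₁ ++ concat Gs₂ ++ T₂        ≡⟨ sym (++-assoc (concat Gs₁) T₁ (concat Gs₂ ++ T₂)) ⟩
  (concat Gs₁ ++ T₁) ++ concat Gs₂ ++ T₂      ∎
  where open ≡-Reasoning

-- maxL [] = 0, hence the positivity assumption.
maxL-< : ∀ G → 0 < b → All (_< b) G → maxL G < b
maxL-< G 0<b = foldr-preservesᵇ ⊔-pres-<m 0<b

maxL-below : ∀ {B} → G ⊑ X → Sorted (X ++ B) → All (0 <_) B → All (maxL G <_) B
maxL-below {G} {X} G⊑X X++B↗ B>0 =
  All.zipWith (λ (b>0 , G<b) → maxL-< G b>0 G<b)
    (B>0 , Allₚ.All-swap (Subₚ.All-resp-⊆ G⊑X (AllPairs-++⁻-between X X++B↗)))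

module GroupSelection (n k : ℕ) .{{_ : NonZero k}} where

  Group : List ℕ → Set
  Group = ExactlyLarge (ω^ n · k)

  -- The maximum of the spare group opens the next term of the target, see chain.
  record Selection (t : Stack) (Y : List ℕ) : Set where
    field
      groups       : List (List ℕ)
      spare        : List ℕ
      groups-exact : All Group groups
      spare-exact  : Group spare
      sublist      : concat groups ++ spare ⊑ Y
      maxima-exact : ExactlyLarge t (map maxL groups)

  open Selection

  weaken : Y ⊑ Z → Selection t Y → Selection t Z
  weaken Y⊑Z S = record
    { groups = groups S ; spare = spare S
    ; groups-exact = groups-exact S ; spare-exact = spare-exact S
    ; sublist = ⊆-trans (sublist S) Y⊑Z ; maxima-exact = maxima-exact S }

  spareOnly : Group G → G ⊑ Y → Selection [] Y
  spareOnly G-exact G⊑Y = record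
    { groups = [] ; spare = _ ; groups-exact = [] ; spare-exact = G-exact
    ; sublist = G⊑Y ; maxima-exact = done }

  spare-⊑ : (S : Selection t Y) → spare S ⊑ Y
  spare-⊑ S = ⊆-trans (Subₚ.++⁺ˡ (concat (groups S)) ⊆-refl) (sublist S)

  chain : (S : Selection s Y) → Selection (step (e ∷ t) (maxL (spare S))) Z →
          Selection (s ++ e ∷ t) (Y ++ Z)
  chain S S′ = record
    { groups       = groups S ++ spare S ∷ groups S′
    ; spare        = spare S′
    ; groups-exact = Allₚ.++⁺ (groups-exact S) (spare-exact S ∷ groups-exact S′)
    ; spare-exact  = spare-exact S′
    ; sublist      = subst (_⊑ _) (sym (concat-++-∷ (groups S) (spare S) (groups S′) (spare S′)))
                       (Subₚ.++⁺ (sublist S) (sublist S′))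
    ; maxima-exact = subst (ExactlyLarge _) (sym (map-++ maxL (groups S) (spare S ∷ groups S′)))
                       (exactlyLarge-++⁺ (maxima-exact S) (next (maxima-exact S′)))
    }

  mutual
    select : ∀ e c → ExactlyLarge (ω^ (suc e + n) · suc (c * k)) Y → All (k ≤_) Y → Sorted Y →
             Selection (ω^ suc e · c) Y
    select e c (next {x = z} p) (k≤z ∷ Y≥k) (z<Y ∷ Y↗) with exactlyLarge-++⁻ (ω^ (e + n) · z) p
    ... | split {Y₀} {Yᵣ} p₀ pᵣ with sub-lowerExponent e k≤z p₀ (Allₚ.++⁻ˡ Y₀ Y≥k)
    ... | G , G⊑Y₀ , G-exact = weaken (z ∷ʳ ⊆-refl) (afterFirst c pᵣ)
      where
      first : Selection [] Y₀
      first = spareOnly G-exact G⊑Y₀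

      afterFirst : ∀ c → ExactlyLarge (ω^ (suc e + n) · (c * k)) Yᵣ →
                   Selection (ω^ suc e · c) (Y₀ ++ Yᵣ)
      afterFirst zero    _  = weaken (Subₚ.++⁺ʳ Yᵣ ⊆-refl) first
      afterFirst (suc c) pᵣ = chain first
        (selectAbove e c (maxL G) pᵣ
          (maxL-below G⊑Y₀ Y↗ (All.map (≤-<-trans z≤n) (Allₚ.++⁻ʳ Y₀ z<Y)))
          (Allₚ.++⁻ʳ Y₀ Y≥k) (AllPairs-++⁻ʳ Y₀ Y↗))

    selectAbove : ∀ e j y → ExactlyLarge (ω^ (suc e + n) · (suc j * k)) Y →
                  All (y <_) Y → All (k ≤_) Y → Sorted Y → Selection (ω^ e · y ++ ω^ suc e · j) Y
    selectAbove e j y p Y>y Y≥k Y↗ with exactlyLarge-ω^·-+⁻ k p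
    ... | split {P} {Yᵣ} pₚ pᵣ with sub-expand k pₚ (Allₚ.++⁻ˡ P Y>y)
    ... | Y′ , Y′⊑P , q = afterRound j pᵣ
      where
      Y′⊑Y : Y′ ⊑ P ++ Yᵣ
      Y′⊑Y = Subₚ.++⁺ʳ Yᵣ Y′⊑P

      S : Selection (ω^ e · y) P
      S = weaken Y′⊑P
        (select′ e y (subst (λ c → ExactlyLarge (ω^ (e + n) · c) Y′) (*-comm k (suc y)) q)
          (Subₚ.All-resp-⊆ Y′⊑Y Y≥k) (AllPairs-resp-⊑ Y′⊑Y Y↗))

      afterRound : ∀ j → ExactlyLarge (ω^ (suc e + n) · (j * k)) Yᵣ →
                   Selection (ω^ e · y ++ ω^ suc e · j) (P ++ Yᵣ)
      afterRound zero    _  =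
        weaken (Subₚ.++⁺ʳ Yᵣ ⊆-refl) (subst (λ t → Selection t P) (sym (++-identityʳ _)) S)
      afterRound (suc j) pᵣ = chain S
        (selectAbove e j (maxL (spare S)) pᵣ
          (maxL-below (spare-⊑ S) Y↗ (All.map (≤-<-trans z≤n) (Allₚ.++⁻ʳ P Y>y)))
          (Allₚ.++⁻ʳ P Y≥k) (AllPairs-++⁻ʳ P Y↗))

    select′ : ∀ e c → ExactlyLarge (ω^ (e + n) · (suc c * k)) Y → All (k ≤_) Y → Sorted Y →
              Selection (ω^ e · c) Y
    select′ {Y = Y} zero c p _ _
      with exactlyLarge-ω^·-+⁻ (c * k) (subst (λ d → ExactlyLarge (ω^ n · d) Y) (+-comm k (c * k)) p)
    ... | split p₁ p₂ with blocks k c p₁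
    ... | Gs , Gs-exact , refl , maxima = record
      { groups = Gs ; spare = _ ; groups-exact = Gs-exact ; spare-exact = p₂
      ; sublist = ⊆-refl ; maxima-exact = maxima }
    select′ (suc e) c p Y≥k Y↗ with sub-fewerTerms (+-monoˡ-≤ (c * k) (>-nonZero⁻¹ k)) p
    ... | Y′ , Y′⊑Y , q =
      weaken Y′⊑Y (select e c q (Subₚ.All-resp-⊆ Y′⊑Y Y≥k) (AllPairs-resp-⊑ Y′⊑Y Y↗))

  selectGroups : ∀ m ℓ → ExactlyLarge (ω^ (m + n) · suc (ℓ * k)) Y → All (k ≤_) Y → Sorted Y →
                 ∃[ Gs ] All Group Gs × concat Gs ⊑ Y × ExactlyLarge (ω^ m · ℓ) (map maxL Gs)
  selectGroups zero ℓ p _ _ with sub-fewerTerms (n≤1+n (ℓ * k)) p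
  ... | Y′ , Y′⊑Y , q with blocks k ℓ q
  ... | Gs , Gs-exact , refl , maxima = Gs , Gs-exact , Y′⊑Y , maxima
  selectGroups (suc m) ℓ p Y≥k Y↗ =
    let S = select m ℓ p Y≥k Y↗
    in groups S , groups-exact S , ⊆-trans (Subₚ.++⁺ʳ (spare S) ⊆-refl) (sublist S) , maxima-exact S

⊑⇒⊆ : G ⊑ X → G ⊆ X
⊑⇒⊆ G⊑X = All.tabulate (Subₚ.Any-resp-⊆ G⊑X)

lookup-fromList-All : {P : A → Set} {xs : List A} → All P xs → ∀ i → P (lookup (fromList xs) i)
lookup-fromList-All ps = VecAllₚ.lookup⁺ (VecAllₚ.fromList⁺ ps)

lookup-fromList-AllPairs : {R : A → A → Set} {xs : List A} → AllPairs R xs →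
                           ∀ i j → i <ᶠ j → R (lookup (fromList xs) i) (lookup (fromList xs) j)
lookup-fromList-AllPairs (r ∷ _) Fin.zero    (Fin.suc j) _         = lookup-fromList-All r j
lookup-fromList-AllPairs (_ ∷ p) (Fin.suc i) (Fin.suc j) (s≤s i<j) = lookup-fromList-AllPairs p i j i<j

blocksVector : {P Q : List ℕ → Set} → ∀ Gs → Sorted X → concat Gs ⊑ X → All P Gs → Q (map maxL Gs) →
  Σ ℕ λ d → Σ (Vec (List ℕ) d) λ Xs →
    ((i : Fin d) → IsSet (lookup Xs i) × (lookup Xs i ⊆ X) × P (lookup Xs i)) ×
    ((i j : Fin d) → i <ᶠ j → lookup Xs i ≺ lookup Xs j) ×
    Q (map maxL (toList Xs))
blocksVector {X = X} {P = P} {Q = Q} Gs X↗ Gs⊑X Gs-P maxima =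
  length Gs , fromList Gs ,
  lookup-fromList-All (All.zipWith properties (each⊑X , Gs-P)) ,
  lookup-fromList-AllPairs (AllPairs-concat⁻ Gs (AllPairs-resp-⊑ Gs⊑X X↗)) ,
  subst (λ Hs → Q (map maxL Hs)) (sym (toList∘fromList Gs)) maxima
  where
  each⊑X : All (_⊑ X) Gs
  each⊑X = All.map (λ G⊑Gs → ⊆-trans G⊑Gs Gs⊑X) (Subₚ.all⊆concat Gs)

  properties : ∀ {G} → G ⊑ X × P G → IsSet G × G ⊆ X × P G
  properties (G⊑X , p) = AllPairs⇒Linked (AllPairs-resp-⊑ G⊑X X↗) , ⊑⇒⊆ G⊑X , p

mainTheorem9 : (n k ℓ m : ℕ) → 1 ≤ n → 1 ≤ k → 1 ≤ ℓ →
    (X : List ℕ) → IsSet X →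
    Large (ωpowMul (fin (n + m)) (k * ℓ + 1)) X →
    All (λ x → k * (ℓ + 1) ≤ x) X →
    Σ ℕ λ d → Σ (Vec (List ℕ) d) λ Xs →
      ((i : Fin d) → IsSet (lookup Xs i) × (lookup Xs i ⊆ X) × Large (ωpowMul (fin n) k) (lookup Xs i)) ×
      ((i j : Fin d) → i <ᶠ j → lookup Xs i ≺ lookup Xs j) ×
      Large (ωpowMul (fin m) ℓ) (map maxL (toList Xs))
mainTheorem9 n k ℓ m _ 1≤k _ X X-set X-large X≥k[ℓ+1] =
  let Y , Y⊑X , Y-exact = Large⇒sub-exactlyLarge (m + n) (suc (ℓ * k)) X X-large′
      Gs , Gs-exact , Gs⊑Y , maxima =
        selectGroups m ℓ Y-exact (Subₚ.All-resp-⊆ Y⊑X X≥k) (AllPairs-resp-⊑ Y⊑X X↗)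
  in blocksVector {P = Large (ωpowMul (fin n) k)} {Q = Large (ωpowMul (fin m) ℓ)} Gs X↗
       (⊆-trans Gs⊑Y Y⊑X) (All.map exactlyLarge⇒Large Gs-exact) (exactlyLarge⇒Large maxima)
  where
  open GroupSelection n k ⦃ >-nonZero 1≤k ⦄

  X-large′ : Large (ωpowMul (fin (m + n)) (suc (ℓ * k))) X
  X-large′ = subst₂ (λ e c → Large (ωpowMul (fin e) c) X)
    (+-comm n m) (trans (+-comm (k * ℓ) 1) (cong suc (*-comm k ℓ))) X-large

  X↗ : Sorted X
  X↗ = Linked⇒AllPairs <-trans X-set

  X≥k : All (k ≤_) X
  X≥k = All.map (≤-trans (subst (λ x → k ≤ k * x) (+-comm 1 ℓ) (m≤m*n k (suc ℓ)))) X≥k[ℓ+1]
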